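{- Let $n\ge 0$ and $k\ge 0$ be integers. The number of ordered pairs of lattice walks, each beginning at the origin and consisting of $n$ unit steps each of which is N $(0,+1)$ or E $(+1,0)$, which have exactly $k$ common vertices other than the origin, is $2^k\binom{2n-k}{n}$.
   Context: Binomial coefficients $\binom{a}{b}$ are $0$ when $b>a$. -}

module Defs where

open import Data.Nat using (ℕ; zero; suc; _+_)
import Data.Nat
import Data.Nat.Combinatorics
import Relation.Nullary
open import Data.Nat.Properties using (_≟_)
open import Data.Product using (_×_; _,_)
open import Data.Product.Properties using (≡-dec)
open import Data.List using (List; []; _∷_; map; length; filter; cartesianProduct; concatMap)
open import Data.List.Membership.DecPropositional using (_∈?_)
open import Relation.Nullary using (Dec)
open import Relation.Binary.PropositionalEquality using (_≡_)

data Step : Set where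
  N E : Step

-- A lattice point (x , y) in ℕ² (walks from the origin with N/E steps stay in ℕ²).
Point : Set
Point = ℕ × ℕ

move : Step → Point → Point
move N (x , y) = (x , suc y)
move E (x , y) = (suc x , y)

verticesFrom : Point → List Step → List Point
verticesFrom p [] = []
verticesFrom p (s ∷ w) = move s p ∷ verticesFrom (move s p) w

vertices : List Step → List Point
vertices = verticesFrom (0 , 0)

walks : ℕ → List (List Step)
walks zero = [] ∷ []
walks (suc n) = concatMap (λ w → (N ∷ w) ∷ (E ∷ w) ∷ []) (walks n)

_≟P_ : (p q : Point) → Dec (p ≡ q)
_≟P_ = ≡-dec _≟_ _≟_

-- Number of common vertices other than the origin (vertices of a
-- N/E walk are pairwise distinct, so counting list entries counts points).
commonVertices : List Step → List Step → ℕ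
commonVertices w₁ w₂ = length (filter (λ p → _∈?_ _≟P_ p (vertices w₂)) (vertices w₁))

countPairs : ℕ → ℕ → ℕ
countPairs n k =
  length (filter (λ ww → commonVertices (Data.Product.proj₁ ww) (Data.Product.proj₂ ww) ≟ k)
                 (cartesianProduct (walks n) (walks n)))

-- Binomial coefficient (a choose b) with integer top a = 2n − k: it is 0 when
-- the top is negative (k > 2n), and the usual n C k otherwise (which is 0 when b > a).
binomTop : ℕ → ℕ → ℕ → ℕ
binomTop twoN k b with Data.Nat._≤?_ k twoN
... | Relation.Nullary.yes _ = Data.Nat.Combinatorics._C_ (twoN Data.Nat.∸ k) b
... | Relation.Nullary.no _ = 0

-- Two walks that start on a common antidiagonal x + y = c stay on a common antidiagonal, so
-- they can only share a vertex after equally many steps, and they do so exactly when their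
-- x-coordinates agree.  Hence the number of pairs of n-step walks meeting k times (the start
-- included) depends only on the gap g between the starting x-coordinates.  Conditioning on
-- the first steps, a pair at gap g moves to gap g (via NN and via EE) and to the two
-- neighbours of g, the neighbour below 0 being 1 by reflection.  The closed form
-- ∑_{j<g} C(2n+1, n+1+j) for no meeting and 2^(k-1) C(2n-k+1, n+g) for k ≥ 1 meetings
-- satisfies the same recurrence, by Pascal's rule and C(2n+1, n) = C(2n+1, n+1).  Two walks
-- from the origin have gap 0 and meet at the start, so k common vertices other than the
-- origin are k + 1 meetings.

module Submission where

open import Defs
open import Data.Nat using (ℕ; zero; suc; _+_; _*_; _^_; _∸_; _≤_; _<_; _≤?_; ∣_-_∣; s≤s)
open import Data.Nat.Properties
  using (_≟_; +-assoc; +-comm; +-identityʳ; +-suc; *-suc; *-zeroʳ; *-identityˡ; +-cancelˡ-≡;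
         +-∸-assoc; m≤m+n; m+n∸m≡n;
         ≤-reflexive; <-trans; <⇒≢; ≰⇒>; m≤n⇒m≤1+n; m≤n⇒m∸n≡0;
         ∣n-n∣≡0; ∣m-n∣≡0⇒m≡n; ∣-∣-identityʳ; ∣-∣-comm)
open import Data.Nat.Combinatorics using (_C_; nCk≡nC[n∸k]; nCk+nC[k+1]≡[n+1]C[k+1])
open import Data.Nat.Tactic.RingSolver using (solve-∀)
open import Data.Bool using (true; false; if_then_else_)
open import Data.Product using (_×_; _,_; proj₁; proj₂)
open import Data.Sum using (_⊎_; inj₁; inj₂)
open import Data.List using (List; []; _∷_; _++_; map; length; filter; concatMap; cartesianProduct)
open import Data.List.Relation.Unary.All as All using (All; []; _∷_)
open import Data.List.Relation.Unary.Any using (here; there)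
open import Data.List.Membership.DecPropositional _≟P_ using (_∈_; _∈?_)
open import Relation.Nullary using (Dec; yes; no; does; ¬_; contradiction)
open import Relation.Binary.PropositionalEquality
  using (_≡_; refl; sym; trans; cong; cong₂; subst; _≢_; module ≡-Reasoning)

open ≡-Reasoning

private
  variable
    A B P Q : Set

∑ : List A → (A → ℕ) → ℕ
∑ [] f = 0
∑ (x ∷ xs) f = f x + ∑ xs f

syntax ∑ xs (λ x → e) = ∑[ x ∈ xs ] e

∑-cong : (xs : List A) {f g : A → ℕ} → (∀ x → f x ≡ g x) → ∑ xs f ≡ ∑ xs g
∑-cong [] f≗g = refl
∑-cong (x ∷ xs) f≗g = cong₂ _+_ (f≗g x) (∑-cong xs f≗g)

∑-cong-All : {xs : List A} {f g : A → ℕ} → All (λ x → f x ≡ g x) xs → ∑ xs f ≡ ∑ xs g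
∑-cong-All [] = refl
∑-cong-All (fx≡gx ∷ rest) = cong₂ _+_ fx≡gx (∑-cong-All rest)

∑-zero : (xs : List A) → ∑[ x ∈ xs ] 0 ≡ 0
∑-zero [] = refl
∑-zero (x ∷ xs) = ∑-zero xs

∑-+ : (xs : List A) (f g : A → ℕ) → ∑[ x ∈ xs ] (f x + g x) ≡ ∑ xs f + ∑ xs g
∑-+ [] f g = refl
∑-+ (x ∷ xs) f g rewrite ∑-+ xs f g = interchange (f x) (g x) (∑ xs f) (∑ xs g)
  where
  interchange : ∀ a b c d → a + b + (c + d) ≡ a + c + (b + d)
  interchange = solve-∀

∑-++ : (xs ys : List A) (f : A → ℕ) → ∑ (xs ++ ys) f ≡ ∑ xs f + ∑ ys f
∑-++ [] ys f = refl
∑-++ (x ∷ xs) ys f rewrite ∑-++ xs ys f = sym (+-assoc (f x) _ _)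

∑-comm : (xs : List A) (ys : List B) (f : A → B → ℕ) →
         ∑[ x ∈ xs ] ∑[ y ∈ ys ] f x y ≡ ∑[ y ∈ ys ] ∑[ x ∈ xs ] f x y
∑-comm [] ys f = sym (∑-zero ys)
∑-comm (x ∷ xs) ys f = begin
  ∑ ys (f x) + ∑[ x′ ∈ xs ] ∑ ys (f x′)          ≡⟨ cong (∑ ys (f x) +_) (∑-comm xs ys f) ⟩
  ∑ ys (f x) + ∑[ y ∈ ys ] ∑[ x′ ∈ xs ] f x′ y   ≡⟨ sym (∑-+ ys (f x) _) ⟩
  ∑[ y ∈ ys ] (f x y + ∑[ x′ ∈ xs ] f x′ y)      ∎

∑-concatMap : (g : A → List B) (xs : List A) (f : B → ℕ) →
              ∑ (concatMap g xs) f ≡ ∑[ x ∈ xs ] ∑ (g x) f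
∑-concatMap g [] f = refl
∑-concatMap g (x ∷ xs) f = trans (∑-++ (g x) _ f) (cong (∑ (g x) f +_) (∑-concatMap g xs f))

∑-cartesianProduct : (xs : List A) (ys : List B) (f : A × B → ℕ) →
                     ∑ (cartesianProduct xs ys) f ≡ ∑[ x ∈ xs ] ∑[ y ∈ ys ] f (x , y)
∑-cartesianProduct [] ys f = refl
∑-cartesianProduct (x ∷ xs) ys f =
  trans (∑-++ (map (x ,_) ys) _ f) (cong₂ _+_ (∑-map ys) (∑-cartesianProduct xs ys f))
  where
  ∑-map : ∀ ys → ∑ (map (x ,_) ys) f ≡ ∑[ y ∈ ys ] f (x , y)
  ∑-map [] = refl
  ∑-map (y ∷ ys) = cong (f (x , y) +_) (∑-map ys)

𝟙 : Dec P → ℕ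
𝟙 P? = if does P? then 1 else 0

𝟙-yes : (P? : Dec P) → P → 𝟙 P? ≡ 1
𝟙-yes (yes _) _ = refl
𝟙-yes (no ¬p) p = contradiction p ¬p

𝟙-no : (P? : Dec P) → ¬ P → 𝟙 P? ≡ 0
𝟙-no (yes p) ¬p = contradiction p ¬p
𝟙-no (no _) _ = refl

𝟙-⇔ : (P → Q) → (Q → P) → (P? : Dec P) (Q? : Dec Q) → 𝟙 P? ≡ 𝟙 Q?
𝟙-⇔ to from P? (yes q) = 𝟙-yes P? (from q)
𝟙-⇔ to from P? (no ¬q) = 𝟙-no P? (λ p → ¬q (to p))

length-filter : {P : A → Set} (P? : ∀ x → Dec (P x)) (xs : List A) →
                length (filter P? xs) ≡ ∑[ x ∈ xs ] 𝟙 (P? x)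
length-filter P? [] = refl
length-filter P? (x ∷ xs) with does (P? x)
... | true = cong suc (length-filter P? xs)
... | false = length-filter P? xs

C-sym : ∀ m n → (m + n) C m ≡ (m + n) C n
C-sym m n = trans (nCk≡nC[n∸k] (m≤m+n m n)) (cong ((m + n) C_) (m+n∸m≡n m n))

central-C-sym : ∀ n → suc (2 * n) C n ≡ suc (2 * n) C suc n
central-C-sym n = subst (λ a → a C n ≡ a C suc n) n+[1+n]≡1+2n (C-sym n (suc n))
  where
  n+[1+n]≡1+2n : n + suc n ≡ suc (2 * n)
  n+[1+n]≡1+2n = trans (+-suc n n) (cong (λ m → suc (n + m)) (sym (+-identityʳ n)))

C-pascal : ∀ a b → suc a C suc b ≡ a C b + a C suc b
C-pascal a b = sym (nCk+nC[k+1]≡[n+1]C[k+1] a b)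

pascal² : (f : ℕ → ℕ → ℕ) → (∀ a b → f (suc a) (suc b) ≡ f a b + f a (suc b)) →
          ∀ a b → f (2 + a) (2 + b) ≡ f a b + 2 * f a (suc b) + f a (2 + b)
pascal² f pascal a b = begin
  f (2 + a) (2 + b)                     ≡⟨ pascal (suc a) (suc b) ⟩
  f (suc a) (suc b) + f (suc a) (2 + b) ≡⟨ cong₂ _+_ (pascal a b) (pascal a (suc b)) ⟩
  (x + y) + (y + z)                     ≡⟨ regroup x y z ⟩
  x + 2 * y + z                         ∎
  where
  x = f a b
  y = f a (suc b)
  z = f a (2 + b)
  regroup : ∀ x y z → (x + y) + (y + z) ≡ x + 2 * y + z
  regroup = solve-∀

binomTop-≤ : ∀ {a k} b → k ≤ a → binomTop a k b ≡ (a ∸ k) C b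
binomTop-≤ {a} {k} b k≤a with k ≤? a
... | yes _ = refl
... | no k≰a = contradiction k≤a k≰a

binomTop-≰ : ∀ {a k} b → ¬ k ≤ a → binomTop a k b ≡ 0
binomTop-≰ {a} {k} b k≰a with k ≤? a
... | yes k≤a = contradiction k≤a k≰a
... | no _ = refl

binomTop-suc-suc : ∀ a k b → binomTop (suc a) (suc k) b ≡ binomTop a k b
binomTop-suc-suc a k b with k ≤? a
... | yes k≤a = binomTop-≤ {suc a} {suc k} b (s≤s k≤a)
... | no k≰a = binomTop-≰ {suc a} {suc k} b (λ { (s≤s k≤a) → k≰a k≤a })

binomTop-pascal : ∀ k a b → binomTop (suc a) k (suc b) ≡ binomTop a k b + binomTop a k (suc b)
binomTop-pascal k a b with k ≤? a
... | yes k≤a = begin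
  binomTop (suc a) k (suc b) ≡⟨ binomTop-≤ (suc b) (m≤n⇒m≤1+n k≤a) ⟩
  (suc a ∸ k) C suc b        ≡⟨ cong (_C suc b) (+-∸-assoc 1 k≤a) ⟩
  suc (a ∸ k) C suc b        ≡⟨ C-pascal (a ∸ k) b ⟩
  (a ∸ k) C b + (a ∸ k) C suc b ∎
... | no k≰a = top-vanishes
  where
  top-vanishes : binomTop (suc a) k (suc b) ≡ 0
  top-vanishes with k ≤? suc a
  ... | yes _ = cong (_C suc b) (m≤n⇒m∸n≡0 (≰⇒> k≰a))
  ... | no _ = refl

level : Point → ℕ
level (x , y) = x + y

level-move : ∀ s p → level (move s p) ≡ suc (level p)
level-move N (x , y) = +-suc x y
level-move E (x , y) = refl

same-level-move : ∀ {p q} s t → level p ≡ level q → level (move s p) ≡ level (move t q)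
same-level-move {p} {q} s t p~q = trans (level-move s p) (trans (cong suc p~q) (sym (level-move t q)))

verticesFrom-above : ∀ p w → All (λ r → level p < level r) (verticesFrom p w)
verticesFrom-above p [] = []
verticesFrom-above p (s ∷ w) = p<p′ ∷ All.map (<-trans p<p′) (verticesFrom-above (move s p) w)
  where
  p<p′ : level p < level (move s p)
  p<p′ = ≤-reflexive (sym (level-move s p))

commonFrom : Point → Point → List Step → List Step → ℕ
commonFrom p q w₁ w₂ = ∑[ r ∈ verticesFrom p w₁ ] 𝟙 (r ∈? verticesFrom q w₂)

commonFrom-step : ∀ p q s t w₁ w₂ → level p ≡ level q →
  commonFrom p q (s ∷ w₁) (t ∷ w₂) ≡ 𝟙 (move s p ≟P move t q) + commonFrom (move s p) (move t q) w₁ w₂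
commonFrom-step p q s t w₁ w₂ p~q = cong₂ _+_ head (∑-cong-All (All.map tail (verticesFrom-above p′ w₁)))
  where
  p′ = move s p
  q′ = move t q
  V₂ = verticesFrom q′ w₂
  p′~q′ : level p′ ≡ level q′
  p′~q′ = same-level-move s t p~q
  head : 𝟙 (p′ ∈? q′ ∷ V₂) ≡ 𝟙 (p′ ≟P q′)
  head = 𝟙-⇔ at-head here (p′ ∈? q′ ∷ V₂) (p′ ≟P q′)
    where
    at-head : p′ ∈ q′ ∷ V₂ → p′ ≡ q′
    at-head (here p′≡q′) = p′≡q′
    at-head (there p′∈V₂) = contradiction (sym p′~q′) (<⇒≢ (All.lookup (verticesFrom-above q′ w₂) p′∈V₂))
  tail : ∀ {r} → level p′ < level r → 𝟙 (r ∈? q′ ∷ V₂) ≡ 𝟙 (r ∈? V₂)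
  tail {r} p′<r = 𝟙-⇔ after-head there (r ∈? q′ ∷ V₂) (r ∈? V₂)
    where
    after-head : r ∈ q′ ∷ V₂ → r ∈ V₂
    after-head (here refl) = contradiction p′~q′ (<⇒≢ p′<r)
    after-head (there r∈V₂) = r∈V₂

advance : Step → ℕ → ℕ
advance N x = x
advance E x = suc x

advance-proj₁ : ∀ s p → advance s (proj₁ p) ≡ proj₁ (move s p)
advance-proj₁ N p = refl
advance-proj₁ E p = refl

-- a and b are the x-coordinates of two walkers on a common antidiagonal.
meetings : ℕ → ℕ → List Step → List Step → ℕ
meetings a b (s ∷ w₁) (t ∷ w₂) = 𝟙 (a ≟ b) + meetings (advance s a) (advance t b) w₁ w₂
meetings a b _ _ = 𝟙 (a ≟ b)

same-level-≡ : ∀ {p q} → level p ≡ level q → proj₁ p ≡ proj₁ q → p ≡ q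
same-level-≡ {x , y} {.x , y′} p~q refl = cong (x ,_) (+-cancelˡ-≡ x y y′ p~q)

𝟙-same-level : ∀ p q → level p ≡ level q → 𝟙 (proj₁ p ≟ proj₁ q) ≡ 𝟙 (p ≟P q)
𝟙-same-level p q p~q = 𝟙-⇔ (same-level-≡ {p} {q} p~q) (cong proj₁) (proj₁ p ≟ proj₁ q) (p ≟P q)

meetings≡commonFrom : ∀ p q w₁ w₂ → level p ≡ level q →
  meetings (proj₁ p) (proj₁ q) w₁ w₂ ≡ 𝟙 (p ≟P q) + commonFrom p q w₁ w₂
meetings≡commonFrom p q [] w₂ p~q =
  trans (𝟙-same-level p q p~q) (sym (+-identityʳ _))
meetings≡commonFrom p q (s ∷ w₁) [] p~q =
  trans (𝟙-same-level p q p~q)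
        (sym (trans (cong (𝟙 (p ≟P q) +_) (∑-zero (verticesFrom p (s ∷ w₁)))) (+-identityʳ _)))
meetings≡commonFrom p q (s ∷ w₁) (t ∷ w₂) p~q = begin
  𝟙 (proj₁ p ≟ proj₁ q) + meetings (advance s (proj₁ p)) (advance t (proj₁ q)) w₁ w₂
    ≡⟨ cong₂ (λ a b → 𝟙 (proj₁ p ≟ proj₁ q) + meetings a b w₁ w₂)
             (advance-proj₁ s p) (advance-proj₁ t q) ⟩
  𝟙 (proj₁ p ≟ proj₁ q) + meetings (proj₁ p′) (proj₁ q′) w₁ w₂
    ≡⟨ cong₂ _+_ (𝟙-same-level p q p~q)
                 (meetings≡commonFrom p′ q′ w₁ w₂ (same-level-move {p} {q} s t p~q)) ⟩
  𝟙 (p ≟P q) + (𝟙 (p′ ≟P q′) + commonFrom p′ q′ w₁ w₂)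
    ≡⟨ cong (𝟙 (p ≟P q) +_) (sym (commonFrom-step p q s t w₁ w₂ p~q)) ⟩
  𝟙 (p ≟P q) + commonFrom p q (s ∷ w₁) (t ∷ w₂) ∎
  where
  p′ = move s p
  q′ = move t q

steps : List Step
steps = N ∷ E ∷ []

∑-walks-suc : ∀ n (f : List Step → ℕ) → ∑ (walks (suc n)) f ≡ ∑[ w ∈ walks n ] ∑[ s ∈ steps ] f (s ∷ w)
∑-walks-suc n f = ∑-concatMap _ (walks n) f

∑-walks-suc² : ∀ n (f : List Step → List Step → ℕ) →
  ∑[ w₁ ∈ walks (suc n) ] ∑[ w₂ ∈ walks (suc n) ] f w₁ w₂ ≡
  ∑[ s ∈ steps ] ∑[ t ∈ steps ] ∑[ w₁ ∈ walks n ] ∑[ w₂ ∈ walks n ] f (s ∷ w₁) (t ∷ w₂)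
∑-walks-suc² n f = begin
  ∑[ w₁ ∈ W′ ] ∑[ w₂ ∈ W′ ] f w₁ w₂
    ≡⟨ ∑-walks-suc n (λ w₁ → ∑[ w₂ ∈ W′ ] f w₁ w₂) ⟩
  ∑[ w₁ ∈ W ] ∑[ s ∈ steps ] ∑[ w₂ ∈ W′ ] f (s ∷ w₁) w₂
    ≡⟨ ∑-cong W (λ w₁ → ∑-cong steps λ s → ∑-walks-suc n (f (s ∷ w₁))) ⟩
  ∑[ w₁ ∈ W ] ∑[ s ∈ steps ] ∑[ w₂ ∈ W ] ∑[ t ∈ steps ] f (s ∷ w₁) (t ∷ w₂)
    ≡⟨ ∑-cong W (λ w₁ → ∑-cong steps λ s → ∑-comm W steps λ w₂ t → f (s ∷ w₁) (t ∷ w₂)) ⟩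
  ∑[ w₁ ∈ W ] ∑[ s ∈ steps ] ∑[ t ∈ steps ] ∑[ w₂ ∈ W ] f (s ∷ w₁) (t ∷ w₂)
    ≡⟨ ∑-comm W steps (λ w₁ s → ∑[ t ∈ steps ] ∑[ w₂ ∈ W ] f (s ∷ w₁) (t ∷ w₂)) ⟩
  ∑[ s ∈ steps ] ∑[ w₁ ∈ W ] ∑[ t ∈ steps ] ∑[ w₂ ∈ W ] f (s ∷ w₁) (t ∷ w₂)
    ≡⟨ ∑-cong steps (λ s → ∑-comm W steps λ w₁ t → ∑[ w₂ ∈ W ] f (s ∷ w₁) (t ∷ w₂)) ⟩
  ∑[ s ∈ steps ] ∑[ t ∈ steps ] ∑[ w₁ ∈ W ] ∑[ w₂ ∈ W ] f (s ∷ w₁) (t ∷ w₂) ∎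
  where
  W = walks n
  W′ = walks (suc n)

meetingCount : ℕ → ℕ → ℕ → ℕ → ℕ
meetingCount n a b k = ∑[ w₁ ∈ walks n ] ∑[ w₂ ∈ walks n ] 𝟙 (meetings a b w₁ w₂ ≟ k)

meetingCount-suc : ∀ n a b k i → 𝟙 (a ≟ b) ≡ i →
  meetingCount (suc n) a b k ≡
  ∑[ s ∈ steps ] ∑[ t ∈ steps ] ∑[ w₁ ∈ walks n ] ∑[ w₂ ∈ walks n ]
    𝟙 (i + meetings (advance s a) (advance t b) w₁ w₂ ≟ k)
meetingCount-suc n a b k i start =
  trans (∑-walks-suc² n λ w₁ w₂ → 𝟙 (meetings a b w₁ w₂ ≟ k)) (cong after-start start)
  where
  after-start : ℕ → ℕ
  after-start i = ∑[ s ∈ steps ] ∑[ t ∈ steps ] ∑[ w₁ ∈ walks n ] ∑[ w₂ ∈ walks n ]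
                    𝟙 (i + meetings (advance s a) (advance t b) w₁ w₂ ≟ k)

meetingCount-suc-meet-zero : ∀ n a → meetingCount (suc n) a a 0 ≡ 0
meetingCount-suc-meet-zero n a = begin
  meetingCount (suc n) a a 0
    ≡⟨ meetingCount-suc n a a 0 1 (𝟙-yes (a ≟ a) refl) ⟩
  ∑[ s ∈ steps ] ∑[ t ∈ steps ] ∑[ w₁ ∈ walks n ] ∑[ w₂ ∈ walks n ] 0
    ≡⟨ ∑-cong steps (λ _ → ∑-cong steps λ _ → ∑∑-zero (walks n) (walks n)) ⟩
  ∑[ s ∈ steps ] ∑[ t ∈ steps ] 0
    ≡⟨ ∑∑-zero steps steps ⟩
  0 ∎
  where
  ∑∑-zero : (xs : List A) (ys : List B) → ∑[ x ∈ xs ] ∑[ y ∈ ys ] 0 ≡ 0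
  ∑∑-zero xs ys = trans (∑-cong xs (λ _ → ∑-zero ys)) (∑-zero xs)

∣n-1+n∣≡1 : ∀ n → ∣ n - suc n ∣ ≡ 1
∣n-1+n∣≡1 zero = refl
∣n-1+n∣≡1 (suc n) = ∣n-1+n∣≡1 n

∣-∣-neighbours : ∀ a b {m} → ∣ a - b ∣ ≡ suc m →
  (∣ a - suc b ∣ ≡ m × ∣ suc a - b ∣ ≡ 2 + m) ⊎ (∣ a - suc b ∣ ≡ 2 + m × ∣ suc a - b ∣ ≡ m)
∣-∣-neighbours zero (suc b) refl = inj₂ (refl , refl)
∣-∣-neighbours (suc a) zero refl = inj₁ (∣-∣-identityʳ a , refl)
∣-∣-neighbours (suc a) (suc b) gap = ∣-∣-neighbours a b gap

∑-steps-gap : ∀ (F : ℕ → ℕ) a b → ∑[ s ∈ steps ] ∑[ t ∈ steps ] F ∣ advance s a - advance t b ∣ ≡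
  2 * F ∣ a - b ∣ + (F ∣ a - suc b ∣ + F ∣ suc a - b ∣)
∑-steps-gap F a b = regroup (F ∣ a - b ∣) (F ∣ a - suc b ∣) (F ∣ suc a - b ∣)
  where
  regroup : ∀ x y z → x + (y + 0) + (z + (x + 0) + 0) ≡ 2 * x + (y + z)
  regroup = solve-∀

∑-steps-meet : ∀ (F : ℕ → ℕ) a → ∑[ s ∈ steps ] ∑[ t ∈ steps ] F ∣ advance s a - advance t a ∣ ≡
  2 * F 0 + (F 1 + F 1)
∑-steps-meet F a = begin
  _ ≡⟨ ∑-steps-gap F a a ⟩
  2 * F ∣ a - a ∣ + (F ∣ a - suc a ∣ + F ∣ suc a - a ∣)
    ≡⟨ cong₂ (λ x y → 2 * F x + y) (∣n-n∣≡0 a)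
             (cong₂ (λ y z → F y + F z) (∣n-1+n∣≡1 a) (trans (∣-∣-comm (suc a) a) (∣n-1+n∣≡1 a))) ⟩
  2 * F 0 + (F 1 + F 1) ∎

∑-steps-apart : ∀ (F : ℕ → ℕ) a b {m} → ∣ a - b ∣ ≡ suc m →
  ∑[ s ∈ steps ] ∑[ t ∈ steps ] F ∣ advance s a - advance t b ∣ ≡ 2 * F (suc m) + (F m + F (2 + m))
∑-steps-apart F a b {m} gap =
  trans (∑-steps-gap F a b) (cong₂ (λ x y → 2 * F x + y) gap (neighbours (∣-∣-neighbours a b gap)))
  where
  neighbours : (∣ a - suc b ∣ ≡ m × ∣ suc a - b ∣ ≡ 2 + m) ⊎
               (∣ a - suc b ∣ ≡ 2 + m × ∣ suc a - b ∣ ≡ m) →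
               F ∣ a - suc b ∣ + F ∣ suc a - b ∣ ≡ F m + F (2 + m)
  neighbours (inj₁ (below , above)) = cong₂ (λ y z → F y + F z) below above
  neighbours (inj₂ (above , below)) = trans (cong₂ (λ y z → F y + F z) above below) (+-comm (F (2 + m)) (F m))

binomialTail : ℕ → ℕ → ℕ
binomialTail n zero = 0
binomialTail n (suc m) = binomialTail n m + suc (2 * n) C suc (m + n)

meetingFormula : ℕ → ℕ → ℕ → ℕ
meetingFormula n m zero = binomialTail n m
meetingFormula n m (suc k) = 2 ^ k * binomTop (2 * n) k (m + n)

binomialTail-zero : ∀ m → binomialTail 0 (suc m) ≡ 1
binomialTail-zero zero = refl
binomialTail-zero (suc m) = trans (+-identityʳ _) (binomialTail-zero m)

binomialTail-suc : ∀ n m → binomialTail (suc n) (suc m) ≡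
                   2 * binomialTail n (suc m) + (binomialTail n m + binomialTail n (2 + m))
binomialTail-suc n zero = begin
  0 + suc (2 * suc n) C (2 + n)             ≡⟨ cong (λ a → 0 + suc a C (2 + n)) (*-suc 2 n) ⟩
  0 + (2 + suc (2 * n)) C (2 + n)           ≡⟨ cong (0 +_) (pascal² _C_ C-pascal (suc (2 * n)) n) ⟩
  0 + (c₀ + 2 * c₁ + c₂)                    ≡⟨ cong (λ c → 0 + (c + 2 * c₁ + c₂)) (central-C-sym n) ⟩
  0 + (c₁ + 2 * c₁ + c₂)                    ≡⟨ regroup c₁ c₂ ⟩
  2 * (0 + c₁) + (0 + ((0 + c₁) + c₂))      ∎
  where
  c₀ = suc (2 * n) C n
  c₁ = suc (2 * n) C suc n
  c₂ = suc (2 * n) C (2 + n)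
  regroup : ∀ x y → 0 + (x + 2 * x + y) ≡ 2 * (0 + x) + (0 + ((0 + x) + y))
  regroup = solve-∀
binomialTail-suc n (suc m) = begin
  binomialTail (suc n) (suc m) + suc (2 * suc n) C suc (suc m + suc n)
    ≡⟨ cong₂ _+_ (binomialTail-suc n m) (cong₂ (λ a b → suc a C suc b) (*-suc 2 n) (+-suc (suc m) n)) ⟩
  2 * (t + c₁) + (t + (t + c₁ + c₂)) + (2 + suc (2 * n)) C (2 + suc (m + n))
    ≡⟨ cong (2 * (t + c₁) + (t + (t + c₁ + c₂)) +_) (pascal² _C_ C-pascal (suc (2 * n)) (suc (m + n))) ⟩
  2 * (t + c₁) + (t + (t + c₁ + c₂)) + (c₁ + 2 * c₂ + c₃)
    ≡⟨ regroup t c₁ c₂ c₃ ⟩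
  2 * (t + c₁ + c₂) + (t + c₁ + (t + c₁ + c₂ + c₃)) ∎
  where
  t = binomialTail n m
  c₁ = suc (2 * n) C suc (m + n)
  c₂ = suc (2 * n) C (2 + (m + n))
  c₃ = suc (2 * n) C (3 + (m + n))
  regroup : ∀ t x y z → 2 * (t + x) + (t + (t + x + y)) + (x + 2 * y + z) ≡
                        2 * (t + x + y) + (t + x + (t + x + y + z))
  regroup = solve-∀

meetingFormula-zero : ∀ m k → meetingFormula 0 m k ≡ 𝟙 (𝟙 (m ≟ 0) ≟ k)
meetingFormula-zero zero zero = refl
meetingFormula-zero zero (suc zero) = refl
meetingFormula-zero zero (suc (suc k)) = *-zeroʳ (2 ^ suc k)
meetingFormula-zero (suc m) zero = binomialTail-zero m
meetingFormula-zero (suc m) (suc zero) = refl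
meetingFormula-zero (suc m) (suc (suc k)) = *-zeroʳ (2 ^ suc k)

meetingFormula-suc-meet : ∀ n k → meetingFormula (suc n) 0 (suc k) ≡
  2 * meetingFormula n 0 k + (meetingFormula n 1 k + meetingFormula n 1 k)
meetingFormula-suc-meet n zero = begin
  1 * binomTop (2 * suc n) 0 (suc n) ≡⟨ *-identityˡ _ ⟩
  2 * suc n C suc n                  ≡⟨ cong (_C suc n) (*-suc 2 n) ⟩
  (2 + 2 * n) C suc n                ≡⟨ C-pascal (suc (2 * n)) n ⟩
  c₀ + c₁                            ≡⟨ cong (_+ c₁) (central-C-sym n) ⟩
  c₁ + c₁                            ∎
  where
  c₀ = suc (2 * n) C n
  c₁ = suc (2 * n) C suc n
meetingFormula-suc-meet n (suc k) = begin
  2 ^ suc k * binomTop (2 * suc n) (suc k) (suc n)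
    ≡⟨ cong (λ a → 2 ^ suc k * binomTop a (suc k) (suc n)) (*-suc 2 n) ⟩
  2 ^ suc k * binomTop (2 + 2 * n) (suc k) (suc n)
    ≡⟨ cong (2 ^ suc k *_) (trans (binomTop-suc-suc (suc (2 * n)) k (suc n))
                                  (binomTop-pascal k (2 * n) n)) ⟩
  2 ^ suc k * (x + y)
    ≡⟨ distrib (2 ^ k) x y ⟩
  2 * (2 ^ k * x) + (2 ^ k * y + 2 ^ k * y) ∎
  where
  x = binomTop (2 * n) k n
  y = binomTop (2 * n) k (suc n)
  distrib : ∀ p x y → 2 * p * (x + y) ≡ 2 * (p * x) + (p * y + p * y)
  distrib = solve-∀

meetingFormula-suc-apart : ∀ n m k → meetingFormula (suc n) (suc m) k ≡
  2 * meetingFormula n (suc m) k + (meetingFormula n m k + meetingFormula n (2 + m) k)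
meetingFormula-suc-apart n m zero = binomialTail-suc n m
meetingFormula-suc-apart n m (suc k) = begin
  2 ^ k * binomTop (2 * suc n) k (suc m + suc n)
    ≡⟨ cong₂ (λ a b → 2 ^ k * binomTop a k (suc b)) (*-suc 2 n) (+-suc m n) ⟩
  2 ^ k * binomTop (2 + 2 * n) k (2 + (m + n))
    ≡⟨ cong (2 ^ k *_) (pascal² (λ a b → binomTop a k b) (binomTop-pascal k) (2 * n) (m + n)) ⟩
  2 ^ k * (x + 2 * y + z)
    ≡⟨ distrib (2 ^ k) x y z ⟩
  2 * (2 ^ k * y) + (2 ^ k * x + 2 ^ k * z) ∎
  where
  x = binomTop (2 * n) k (m + n)
  y = binomTop (2 * n) k (suc (m + n))
  z = binomTop (2 * n) k (2 + (m + n))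
  distrib : ∀ p x y z → p * (x + 2 * y + z) ≡ 2 * (p * y) + (p * x + p * z)
  distrib = solve-∀

meetingCount≡meetingFormula : ∀ n a b k → meetingCount n a b k ≡ meetingFormula n ∣ a - b ∣ k
meetingCount≡meetingFormula zero a b k = begin
  𝟙 (𝟙 (a ≟ b) ≟ k) + 0 + 0             ≡⟨ trans (+-identityʳ _) (+-identityʳ _) ⟩
  𝟙 (𝟙 (a ≟ b) ≟ k)
    ≡⟨ cong (λ i → 𝟙 (i ≟ k)) (𝟙-⇔ (λ { refl → ∣n-n∣≡0 a }) ∣m-n∣≡0⇒m≡n (a ≟ b) (∣ a - b ∣ ≟ 0)) ⟩
  𝟙 (𝟙 (∣ a - b ∣ ≟ 0) ≟ k)             ≡⟨ sym (meetingFormula-zero ∣ a - b ∣ k) ⟩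
  meetingFormula 0 ∣ a - b ∣ k          ∎
meetingCount≡meetingFormula (suc n) a b k with a ≟ b
... | yes refl rewrite ∣n-n∣≡0 a = meet k
  where
  meet : ∀ k → meetingCount (suc n) a a k ≡ meetingFormula (suc n) 0 k
  meet zero = meetingCount-suc-meet-zero n a
  meet (suc k) = begin
    meetingCount (suc n) a a (suc k)
      ≡⟨ meetingCount-suc n a a (suc k) 1 (𝟙-yes (a ≟ a) refl) ⟩
    ∑[ s ∈ steps ] ∑[ t ∈ steps ] meetingCount n (advance s a) (advance t a) k
      ≡⟨ ∑-cong steps (λ s → ∑-cong steps λ t → meetingCount≡meetingFormula n (advance s a) (advance t a) k) ⟩
    ∑[ s ∈ steps ] ∑[ t ∈ steps ] meetingFormula n ∣ advance s a - advance t a ∣ k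
      ≡⟨ ∑-steps-meet (λ g → meetingFormula n g k) a ⟩
    2 * meetingFormula n 0 k + (meetingFormula n 1 k + meetingFormula n 1 k)
      ≡⟨ sym (meetingFormula-suc-meet n k) ⟩
    meetingFormula (suc n) 0 (suc k) ∎
... | no a≢b with ∣ a - b ∣ in gap
...   | zero = contradiction (∣m-n∣≡0⇒m≡n gap) a≢b
...   | suc m = begin
  meetingCount (suc n) a b k
    ≡⟨ meetingCount-suc n a b k 0 (𝟙-no (a ≟ b) a≢b) ⟩
  ∑[ s ∈ steps ] ∑[ t ∈ steps ] meetingCount n (advance s a) (advance t b) k
    ≡⟨ ∑-cong steps (λ s → ∑-cong steps λ t → meetingCount≡meetingFormula n (advance s a) (advance t b) k) ⟩
  ∑[ s ∈ steps ] ∑[ t ∈ steps ] meetingFormula n ∣ advance s a - advance t b ∣ k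
    ≡⟨ ∑-steps-apart (λ g → meetingFormula n g k) a b gap ⟩
  2 * meetingFormula n (suc m) k + (meetingFormula n m k + meetingFormula n (2 + m) k)
    ≡⟨ sym (meetingFormula-suc-apart n m k) ⟩
  meetingFormula (suc n) (suc m) k ∎

countPairs≡meetingCount : ∀ n k → countPairs n k ≡ meetingCount n 0 0 (suc k)
countPairs≡meetingCount n k = begin
  countPairs n k
    ≡⟨ length-filter _ (cartesianProduct (walks n) (walks n)) ⟩
  ∑ (cartesianProduct (walks n) (walks n)) (λ ww → 𝟙 (commonVertices (proj₁ ww) (proj₂ ww) ≟ k))
    ≡⟨ ∑-cartesianProduct (walks n) (walks n) _ ⟩
  ∑[ w₁ ∈ walks n ] ∑[ w₂ ∈ walks n ] 𝟙 (commonVertices w₁ w₂ ≟ k)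
    ≡⟨ ∑-cong (walks n) (λ w₁ → ∑-cong (walks n) λ w₂ →
         cong (λ c → 𝟙 (c ≟ suc k)) (sym (meetings≡1+commonVertices w₁ w₂))) ⟩
  meetingCount n 0 0 (suc k) ∎
  where
  meetings≡1+commonVertices : ∀ w₁ w₂ → meetings 0 0 w₁ w₂ ≡ suc (commonVertices w₁ w₂)
  meetings≡1+commonVertices w₁ w₂ =
    trans (meetings≡commonFrom (0 , 0) (0 , 0) w₁ w₂ refl) (cong suc (sym (length-filter _ (vertices w₁))))

theorem3 : (n k : ℕ) → countPairs n k ≡ 2 ^ k * binomTop (2 * n) k n
theorem3 n k = begin
  countPairs n k                         ≡⟨ countPairs≡meetingCount n k ⟩
  meetingCount n 0 0 (suc k)             ≡⟨ meetingCount≡meetingFormula n 0 0 (suc k) ⟩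
  2 ^ k * binomTop (2 * n) k n           ∎
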